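{- Let $n$ and $t$ be positive integers such that $n$ is even and $n\geqslant 6t-2$, and let $e_i=\binom{n/2}{t-i}\binom{n/2}{t+i}$ for each $i\in\{0,\ldots,t\}$. Then $e_i>e_{i+1}+t$ for each $i\in\{0,\ldots,t-1\}$. -}

module Defs where

open import Data.Nat using (ℕ; _*_; _∸_; _+_; _/_)
open import Data.Nat.Combinatorics using (_C_)

-- e n t i = C(n/2, t-i) * C(n/2, t+i)   (used only for 0 ≤ i ≤ t, so t ∸ i is honest subtraction)
e : ℕ → ℕ → ℕ → ℕ
e n t i = ((n / 2) C (t ∸ i)) * ((n / 2) C (t + i))

-- Write X = C(m,a), U = C(m,a+1), V = C(m,b), W = C(m,b+1) with a < b ≤ m.  Absorption,
-- (k+1) C(m,k+1) = (m-k) C(m,k), turns the two products into multiples of XV, and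
--   (a+1)(b+1)(UV - XW) = (b-a)(m+1) XV ≥ (m+1) C(m,b).
-- For a = t-i-1 and b = t+i we have (a+1)(b+1) ≤ 2t², so it suffices that (m+1) C(m,b) > 2t³.
-- When t ≥ 2, the bounds t ≤ b < 2t and m ≥ 3t-1 put b between 2 and m-2, hence
-- C(m,b) ≥ C(m,2) = m(m-1)/2; when t = 1, b = 1 and (m+1) C(m,1) = (m+1)m.
module Submission where

open import Defs
open import Data.Nat using (ℕ; zero; suc; _*_; _∸_; _+_; _<_; _≤_; z≤n; s≤s; ≤-pred; >-nonZero)
open import Data.Nat.Divisibility using (_∣_; divides)
open import Data.Nat.Properties
open import Data.Nat.Combinatorics using (_C_; nC1≡n; nCk+nC[k+1]≡[n+1]C[k+1])
open import Data.Nat.DivMod using (m*n/n≡m)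
open import Data.Nat.Tactic.RingSolver using (solve)
open import Data.List using (_∷_; [])
open import Data.Product using (_,_)
open import Algebra.Properties.CommutativeSemigroup *-commutativeSemigroup using (x∙yz≈y∙xz)
open import Relation.Binary.PropositionalEquality using (_≡_; refl; sym; trans; cong; cong₂; subst; module ≡-Reasoning)

nCk≤[1+n]C[1+k] : ∀ n k → n C k ≤ suc n C suc k
nCk≤[1+n]C[1+k] n k = ≤-trans (m≤m+n _ _) (≤-reflexive (nCk+nC[k+1]≡[n+1]C[k+1] n k))

nCk>0 : ∀ {n k} → k ≤ n → 0 < n C k
nCk>0 {k = zero}  _         = s≤s z≤n
nCk>0 {suc n} {suc k} (s≤s k≤n) = <-≤-trans (nCk>0 k≤n) (nCk≤[1+n]C[1+k] n k)

n≤nCk : ∀ {n k} → 0 < k → k < n → n ≤ n C k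
n≤nCk {suc n} {suc zero} _ _ = ≤-reflexive (sym (nC1≡n (suc n)))
n≤nCk {suc n} {suc (suc k)} _ (s≤s k<n) = begin
  suc n                       ≡⟨ +-comm 1 n ⟩
  n + 1                       ≤⟨ +-mono-≤ (n≤nCk (s≤s z≤n) k<n) (nCk>0 k<n) ⟩
  n C suc k + n C suc (suc k) ≡⟨ nCk+nC[k+1]≡[n+1]C[k+1] n (suc k) ⟩
  suc n C suc (suc k)         ∎
  where open ≤-Reasoning

nC2≤nCk : ∀ {n k} → 2 ≤ k → 2 + k ≤ n → n C 2 ≤ n C k
nC2≤nCk {k = 1} (s≤s ()) _
nC2≤nCk {k = 2} _ _ = ≤-refl
nC2≤nCk {suc n} {suc k@(suc (suc _))} _ (s≤s 2+k≤n) = begin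
  suc n C 2               ≡⟨ nCk+nC[k+1]≡[n+1]C[k+1] n 1 ⟨
  n C 1 + n C 2           ≡⟨ cong (_+ n C 2) (nC1≡n n) ⟩
  n + n C 2               ≤⟨ +-mono-≤ (n≤nCk (s≤s z≤n) 2+k≤n) (nC2≤nCk (s≤s (s≤s z≤n)) 2+k≤n) ⟩
  n C suc k + n C k       ≡⟨ +-comm (n C suc k) (n C k) ⟩
  n C k + n C suc k       ≡⟨ nCk+nC[k+1]≡[n+1]C[k+1] n k ⟩
  suc n C suc k           ∎
  where open ≤-Reasoning

[1+k]*[1+n]C[1+k]≡[1+n]*nCk : ∀ n k → suc k * (suc n C suc k) ≡ suc n * (n C k)
[1+k]*[1+n]C[1+k]≡[1+n]*nCk zero    zero    = refl
[1+k]*[1+n]C[1+k]≡[1+n]*nCk zero    (suc k) = *-zeroʳ (2 + k)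
[1+k]*[1+n]C[1+k]≡[1+n]*nCk (suc n) zero    = trans (+-identityʳ _) (trans (nC1≡n (2 + n)) (sym (*-identityʳ _)))
[1+k]*[1+n]C[1+k]≡[1+n]*nCk (suc n) (suc k) = begin
  (2 + k) * ((2 + n) C (2 + k))
    ≡⟨ cong ((2 + k) *_) (nCk+nC[k+1]≡[n+1]C[k+1] (suc n) (suc k)) ⟨
  (2 + k) * (x + y)
    ≡⟨ *-distribˡ-+ (2 + k) x y ⟩
  (x + (1 + k) * x) + (2 + k) * y
    ≡⟨ cong₂ (λ u v → (x + u) + v) ([1+k]*[1+n]C[1+k]≡[1+n]*nCk n k) ([1+k]*[1+n]C[1+k]≡[1+n]*nCk n (suc k)) ⟩
  (x + (1 + n) * (n C k)) + (1 + n) * (n C suc k)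
    ≡⟨ +-assoc x _ _ ⟩
  x + ((1 + n) * (n C k) + (1 + n) * (n C suc k))
    ≡⟨ cong (x +_) (*-distribˡ-+ (1 + n) (n C k) (n C suc k)) ⟨
  x + (1 + n) * (n C k + n C suc k)
    ≡⟨ cong (λ z → x + (1 + n) * z) (nCk+nC[k+1]≡[n+1]C[k+1] n k) ⟩
  (2 + n) * x
    ∎
  where
  open ≡-Reasoning
  x : ℕ
  x = suc n C suc k
  y : ℕ
  y = suc n C (2 + k)

[1+k]*nC[1+k]+k*nCk≡n*nCk : ∀ n k → suc k * (n C suc k) + k * (n C k) ≡ n * (n C k)
[1+k]*nC[1+k]+k*nCk≡n*nCk zero    zero    = refl
[1+k]*nC[1+k]+k*nCk≡n*nCk zero    (suc k) = cong₂ _+_ (*-zeroʳ (2 + k)) (*-zeroʳ (1 + k))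
[1+k]*nC[1+k]+k*nCk≡n*nCk (suc n) zero    =
  trans (+-identityʳ _) (trans (*-identityˡ _) (trans (nC1≡n (suc n)) (sym (*-identityʳ _))))
[1+k]*nC[1+k]+k*nCk≡n*nCk (suc n) (suc k) = begin
  (2 + k) * (suc n C (2 + k)) + (1 + k) * (suc n C suc k)
    ≡⟨ cong₂ _+_ ([1+k]*[1+n]C[1+k]≡[1+n]*nCk n (suc k)) ([1+k]*[1+n]C[1+k]≡[1+n]*nCk n k) ⟩
  (1 + n) * (n C suc k) + (1 + n) * (n C k)
    ≡⟨ +-comm ((1 + n) * (n C suc k)) _ ⟩
  (1 + n) * (n C k) + (1 + n) * (n C suc k)
    ≡⟨ *-distribˡ-+ (1 + n) (n C k) (n C suc k) ⟨
  (1 + n) * (n C k + n C suc k)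
    ≡⟨ cong ((1 + n) *_) (nCk+nC[k+1]≡[n+1]C[k+1] n k) ⟩
  (1 + n) * (suc n C suc k)
    ∎
  where open ≡-Reasoning

[1+k]*nC[1+k]≡[n∸k]*nCk : ∀ n k → suc k * (n C suc k) ≡ (n ∸ k) * (n C k)
[1+k]*nC[1+k]≡[n∸k]*nCk n k = begin
  suc k * (n C suc k)
    ≡⟨ m+n∸n≡m _ (k * (n C k)) ⟨
  suc k * (n C suc k) + k * (n C k) ∸ k * (n C k)
    ≡⟨ cong (_∸ k * (n C k)) ([1+k]*nC[1+k]+k*nCk≡n*nCk n k) ⟩
  n * (n C k) ∸ k * (n C k)
    ≡⟨ *-distribʳ-∸ (n C k) n k ⟨
  (n ∸ k) * (n C k)
    ∎
  where open ≡-Reasoning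

cross-identity : ∀ a d c X U V W → suc a * U ≡ (d + c) * X → suc (a + d) * W ≡ c * V →
  suc a * suc (a + d) * (U * V) ≡ suc a * suc (a + d) * (X * W) + d * X * (suc (a + d + c) * V)
cross-identity a d c X U V W a∙U≡[d+c]∙X b∙W≡c∙V = begin
  suc a * suc (a + d) * (U * V)
    ≡⟨ solve (a ∷ d ∷ U ∷ V ∷ []) ⟩
  (suc a * U) * (suc (a + d) * V)
    ≡⟨ cong (_* (suc (a + d) * V)) a∙U≡[d+c]∙X ⟩
  (d + c) * X * (suc (a + d) * V)
    ≡⟨ solve (a ∷ d ∷ c ∷ X ∷ V ∷ []) ⟩
  suc a * X * (c * V) + d * X * (suc (a + d + c) * V)
    ≡⟨ cong (λ z → suc a * X * z + d * X * (suc (a + d + c) * V)) b∙W≡c∙V ⟨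
  suc a * X * (suc (a + d) * W) + d * X * (suc (a + d + c) * V)
    ≡⟨ solve (a ∷ d ∷ c ∷ X ∷ V ∷ W ∷ []) ⟩
  suc a * suc (a + d) * (X * W) + d * X * (suc (a + d + c) * V)
    ∎
  where open ≡-Reasoning

binomial-cross-identity : ∀ {n a b} → a ≤ b → b ≤ n →
  suc a * suc b * ((n C suc a) * (n C b)) ≡
    suc a * suc b * ((n C a) * (n C suc b)) + (b ∸ a) * (n C a) * (suc n * (n C b))
binomial-cross-identity {a = a} a≤b b≤n with m≤n⇒∃[o]m+o≡n a≤b | m≤n⇒∃[o]m+o≡n b≤n
... | d , refl | c , refl rewrite m+n∸m≡n a d =
    cross-identity a d c (n C a) (n C suc a) (n C (a + d)) (n C suc (a + d))
      (trans ([1+k]*nC[1+k]≡[n∸k]*nCk n a) (cong (_* (n C a)) n∸a≡d+c))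
      (trans ([1+k]*nC[1+k]≡[n∸k]*nCk n (a + d)) (cong (_* (n C (a + d))) (m+n∸m≡n (a + d) c)))
  where
  n : ℕ
  n = a + d + c
  n∸a≡d+c : n ∸ a ≡ d + c
  n∸a≡d+c = trans (cong (_∸ a) (+-assoc a d c)) (m+n∸m≡n a (d + c))

binomial-cross-gap : ∀ {n a b s} → a < b → b ≤ n → suc a * suc b * s < suc n * (n C b) →
  (n C a) * (n C suc b) + s < (n C suc a) * (n C b)
binomial-cross-gap {n} {a} {b} {s} a<b b≤n K∙s<[1+n]∙V = *-cancelˡ-< K _ _ (begin-strict
  K * (X * W + s)                         ≡⟨ *-distribˡ-+ K (X * W) s ⟩
  K * (X * W) + K * s                     <⟨ +-monoʳ-< (K * (X * W)) (<-≤-trans K∙s<[1+n]∙V [1+n]∙V≤gap) ⟩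
  K * (X * W) + (b ∸ a) * X * (suc n * V) ≡⟨ binomial-cross-identity (<⇒≤ a<b) b≤n ⟨
  K * (U * V)                             ∎)
  where
  open ≤-Reasoning
  K : ℕ
  K = suc a * suc b
  X : ℕ
  X = n C a
  U : ℕ
  U = n C suc a
  V : ℕ
  V = n C b
  W : ℕ
  W = n C suc b
  [b∸a]∙X>0 : 0 < (b ∸ a) * X
  [b∸a]∙X>0 = *-mono-≤ (m<n⇒0<n∸m a<b) (nCk>0 (≤-trans (<⇒≤ a<b) b≤n))
  [1+n]∙V≤gap : suc n * V ≤ (b ∸ a) * X * (suc n * V)
  [1+n]∙V≤gap = m≤n*m (suc n * V) ((b ∸ a) * X) {{>-nonZero [b∸a]∙X>0}}

2*nC2≡[n∸1]*n : ∀ n → 2 * (n C 2) ≡ (n ∸ 1) * n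
2*nC2≡[n∸1]*n n = trans ([1+k]*nC[1+k]≡[n∸k]*nCk n 1) (cong ((n ∸ 1) *_) (nC1≡n n))

t*2t*t<[1+n]*nCk : ∀ {n k t} → t ≤ k → k < 2 * t → 3 * t ≤ suc n → t * (2 * t) * t < suc n * (n C k)
t*2t*t<[1+n]*nCk {k = 0} z≤n () _
t*2t*t<[1+n]*nCk {k = 1} z≤n () _
t*2t*t<[1+n]*nCk {n} {1} (s≤s z≤n) _ (s≤s 2≤n) = begin-strict
  2               <⟨ s≤s 2≤n ⟩
  suc n           ≤⟨ m≤m*n (suc n) n {{>-nonZero (≤-trans (s≤s z≤n) 2≤n)}} ⟩
  suc n * n       ≡⟨ cong (suc n *_) (nC1≡n n) ⟨
  suc n * (n C 1) ∎
  where open ≤-Reasoning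
t*2t*t<[1+n]*nCk {n} {k@(suc (suc _))} {t} _ k<2t 3t≤1+n = *-cancelˡ-< 2 _ _ (begin-strict
  2 * (t * (2 * t) * t)       ≡⟨ solve (t ∷ []) ⟩
  t * (2 * t * (2 * t))       <⟨ *-monoˡ-< (2 * t * (2 * t)) {{>-nonZero (*-mono-< 0<2t 0<2t)}} t<1+n ⟩
  suc n * (2 * t * (2 * t))   ≤⟨ *-monoʳ-≤ (suc n) (*-mono-≤ (∸-monoˡ-≤ 1 1+2t≤n) (<⇒≤ 1+2t≤n)) ⟩
  suc n * ((n ∸ 1) * n)       ≡⟨ cong (suc n *_) (2*nC2≡[n∸1]*n n) ⟨
  suc n * (2 * (n C 2))       ≤⟨ *-monoʳ-≤ (suc n) (*-monoʳ-≤ 2 (nC2≤nCk (s≤s (s≤s z≤n)) (≤-trans (s≤s k<2t) 1+2t≤n))) ⟩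
  suc n * (2 * (n C k))       ≡⟨ x∙yz≈y∙xz (suc n) 2 (n C k) ⟩
  2 * (suc n * (n C k))       ∎)
  where
  open ≤-Reasoning
  2≤t : 2 ≤ t
  2≤t = *-cancelˡ-< 2 1 t (≤-trans (s≤s (s≤s (s≤s z≤n))) k<2t)
  1+2t≤n : suc (2 * t) ≤ n
  1+2t≤n = ≤-pred (≤-trans (+-monoˡ-≤ (2 * t) 2≤t) 3t≤1+n)
  0<2t : 0 < 2 * t
  0<2t = *-monoʳ-< 2 (≤-trans (s≤s z≤n) 2≤t)
  t<1+n : t < suc n
  t<1+n = s≤s (≤-trans (m≤m+n t (t + 0)) (<⇒≤ 1+2t≤n))

3t≤1+m : ∀ t m → 6 * t ∸ 2 ≤ m * 2 → 3 * t ≤ suc m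
3t≤1+m t m 6t∸2≤2m = *-cancelˡ-≤ 2 (begin
  2 * (3 * t)        ≡⟨ *-assoc 2 3 t ⟨
  6 * t              ≤⟨ m≤n+m∸n (6 * t) 2 ⟩
  2 + (6 * t ∸ 2)    ≤⟨ +-monoʳ-≤ 2 6t∸2≤2m ⟩
  2 + m * 2          ≡⟨ solve (m ∷ []) ⟩
  2 * suc m          ∎)
  where open ≤-Reasoning

symmetric-binomial-gap : ∀ {m t i} → 3 * t ≤ suc m → i < t →
  (m C (t ∸ suc i)) * (m C (t + suc i)) + t < (m C (t ∸ i)) * (m C (t + i))
symmetric-binomial-gap {m} {t} {i} 3t≤1+m i<t rewrite +-suc t i | +-∸-assoc 1 i<t =
  binomial-cross-gap a<t+i t+i≤m (begin-strict
    suc a * suc (t + i) * t  ≤⟨ *-monoˡ-≤ t (*-mono-≤ 1+a≤t t+i<2t) ⟩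
    t * (2 * t) * t          <⟨ t*2t*t<[1+n]*nCk (m≤m+n t i) t+i<2t 3t≤1+m ⟩
    suc m * (m C (t + i))    ∎)
  where
  open ≤-Reasoning
  a : ℕ
  a = t ∸ suc i
  t∸i≡1+a : t ∸ i ≡ suc a
  t∸i≡1+a = +-∸-assoc 1 i<t
  1+a≤t : suc a ≤ t
  1+a≤t = ≤-trans (≤-reflexive (sym t∸i≡1+a)) (m∸n≤m t i)
  a<t+i : a < t + i
  a<t+i = ≤-trans 1+a≤t (m≤m+n t i)
  t+i<2t : t + i < 2 * t
  t+i<2t = ≤-trans (+-monoʳ-< t i<t) (≤-reflexive (cong (t +_) (sym (+-identityʳ t))))
  t+i≤m : t + i ≤ m
  t+i≤m = ≤-pred (≤-trans t+i<2t (≤-trans (m≤n+m (2 * t) t) 3t≤1+m))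

lemma9 : (n t : ℕ) → 0 < n → 0 < t → 2 ∣ n → 6 * t ∸ 2 ≤ n →
           (i : ℕ) → i < t → e n t (suc i) + t < e n t i
lemma9 .(m * 2) t _ _ (divides m refl) 6t∸2≤n i i<t =
  subst (λ k → (k C (t ∸ suc i)) * (k C (t + suc i)) + t < (k C (t ∸ i)) * (k C (t + i)))
    (sym (m*n/n≡m m 2))
    (symmetric-binomial-gap (3t≤1+m t m 6t∸2≤n) i<t)
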